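{- The binary Champernowne constant $\mathcal C_2=0.\,1\,10\,11\,100\,101\,110\,111\ldots$ is typical, i.e. its binary expansion $x$ satisfies $\lim_{n\to\infty}\frac{L_n(x)}{\log_2 n}=1$.
   Context: The binary digits of $\mathcal C_2$ are obtained by concatenating the binary notations of $1,2,3,\dots$. For $x\in\{0,1\}^{\mathbb N}$, $L_n(x)$ is the length of the longest run of consecutive ones among $x_1,\dots,x_n$. -}

module Defs where

open import Data.Bool using (Bool; true; false)
open import Data.Nat using (ℕ; zero; suc; _+_; _*_; _^_; _<_; _≤_; _⊔_)
open import Data.Nat.DivMod using (_/_; _%_)
open import Data.List using (List; []; _∷_; _++_; reverse; take; concatMap; upTo; map)

-- Little-endian binary digits of n, computed with fuel (fuel ≥ n suffices).
bitsLE : ℕ → ℕ → List Bool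
bitsLE zero    _       = []
bitsLE (suc f) zero    = []
bitsLE (suc f) (suc m) = bit ∷ bitsLE f (suc m / 2)
  where
  bit : Bool
  bit with suc m % 2
  ... | zero = false
  ... | suc _ = true

binary : ℕ → List Bool
binary n = reverse (bitsLE n n)

-- The first n binary digits x₁ … xₙ of the binary Champernowne constant
-- C₂ = 0.1 10 11 100 101 ... : concatenation of binary notations of 1,2,3,...
-- Each of 1..n contributes at least one digit, so binaries of 1..n suffice.
champPrefix : ℕ → List Bool
champPrefix n = take n (concatMap (λ k → binary (suc k)) (upTo n))

runAux : ℕ → ℕ → List Bool → ℕ
runAux cur best []           = best
runAux cur best (true  ∷ bs) = runAux (suc cur) (best ⊔ suc cur) bs
runAux cur best (false ∷ bs) = runAux zero best bs

longestRun : List Bool → ℕ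
longestRun = runAux 0 0

L : ℕ → ℕ
L n = longestRun (champPrefix n)

{-# OPTIONS --safe #-}

-- Write C m for the concatenation of the binary notations of 1, …, m.  A run of ones in C m
-- lies inside one block binary i or straddles the boundary between binary i and binary (i+1);
-- since adding 1 turns the e trailing ones of i into zeros, binary (i+1) then has at most
-- |binary (i+1)| − e leading ones.  Hence every run in C m is at most the bit length of m, and
-- L n ≤ log₂ n + 1.  Conversely binary (2^j − 1) is a run of j ones and ends C (2^j − 1), of
-- length at most j·2^j, so j ≤ L n as soon as j·2^j ≤ n.  Bracketing n between consecutive
-- powers 2^t (upper bound) or 2^((k+2)t) (lower bound) turns both into the stated inequalities.
module Submission where

open import Defs
open import Data.Bool using (Bool; true; false)
open import Data.List using (List; []; _∷_; _++_; _∷ʳ_; length; take; drop; replicate; reverse; concatMap; upTo)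
open import Data.List.Properties
  using (++-identityʳ; ++-assoc; length-++; take++drop≡id; unfold-reverse; concatMap-++; upTo-∷ʳ)
open import Data.Nat
open import Data.Nat.DivMod using (_/_; _%_; m*n/n≡m; m*n%n≡0; [m+kn]%n≡m%n; +-distrib-/)
open import Data.Nat.Properties
open import Data.Nat.Tactic.RingSolver using (solve-∀)
open import Data.Product using (Σ; ∃; _×_; _,_)
open import Function using (_∘_)
open import Relation.Binary.PropositionalEquality
open import Relation.Nullary using (yes; no)

-- The counter `cur` of runAux after reading the list: its final run of ones, plus c if the
-- list consists of ones only.
endRun : ℕ → List Bool → ℕ
endRun c []           = c
endRun c (true  ∷ bs) = endRun (suc c) bs
endRun c (false ∷ bs) = endRun zero bs

leadingOnes : List Bool → ℕ
leadingOnes []           = zero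
leadingOnes (true  ∷ bs) = suc (leadingOnes bs)
leadingOnes (false ∷ bs) = zero

runAux-++ : ∀ c b xs ys → runAux c b (xs ++ ys) ≡ runAux (endRun c xs) (runAux c b xs) ys
runAux-++ c b []           ys = refl
runAux-++ c b (true  ∷ xs) ys = runAux-++ (suc c) (b ⊔ suc c) xs ys
runAux-++ c b (false ∷ xs) ys = runAux-++ zero b xs ys

endRun-++ : ∀ c xs ys → endRun c (xs ++ ys) ≡ endRun (endRun c xs) ys
endRun-++ c []           ys = refl
endRun-++ c (true  ∷ xs) ys = endRun-++ (suc c) xs ys
endRun-++ c (false ∷ xs) ys = endRun-++ zero xs ys

endRun-∷ʳ-false : ∀ c xs → endRun c (xs ∷ʳ false) ≡ 0
endRun-∷ʳ-false c xs = endRun-++ c xs (false ∷ [])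

endRun-∷ʳ-true : ∀ c xs → endRun c (xs ∷ʳ true) ≡ suc (endRun c xs)
endRun-∷ʳ-true c xs = endRun-++ c xs (true ∷ [])

leadingOnes-∷ʳ-false : ∀ xs → leadingOnes (xs ∷ʳ false) ≡ leadingOnes xs
leadingOnes-∷ʳ-false []           = refl
leadingOnes-∷ʳ-false (true  ∷ xs) = cong suc (leadingOnes-∷ʳ-false xs)
leadingOnes-∷ʳ-false (false ∷ xs) = refl

leadingOnes≤length : ∀ xs → leadingOnes xs ≤ length xs
leadingOnes≤length []           = z≤n
leadingOnes≤length (true  ∷ xs) = s≤s (leadingOnes≤length xs)
leadingOnes≤length (false ∷ xs) = z≤n

leadingOnes-replicate : ∀ j → leadingOnes (replicate j true) ≡ j
leadingOnes-replicate zero    = refl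
leadingOnes-replicate (suc j) = cong suc (leadingOnes-replicate j)

best≤runAux : ∀ c b xs → b ≤ runAux c b xs
best≤runAux c b []           = ≤-refl
best≤runAux c b (true  ∷ xs) = ≤-trans (m≤m⊔n b (suc c)) (best≤runAux (suc c) (b ⊔ suc c) xs)
best≤runAux c b (false ∷ xs) = best≤runAux zero b xs

runAux-mono : ∀ {c c′ b b′} xs → c ≤ c′ → b ≤ b′ → runAux c b xs ≤ runAux c′ b′ xs
runAux-mono []           c≤c′ b≤b′ = b≤b′
runAux-mono (true  ∷ xs) c≤c′ b≤b′ = runAux-mono xs (s≤s c≤c′) (⊔-mono-≤ b≤b′ (s≤s c≤c′))
runAux-mono (false ∷ xs) c≤c′ b≤b′ = runAux-mono xs z≤n b≤b′

+leadingOnes≤runAux : ∀ c b xs → c ≤ b → c + leadingOnes xs ≤ runAux c b xs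
+leadingOnes≤runAux c b []           c≤b = ≤-trans (≤-reflexive (+-identityʳ c)) c≤b
+leadingOnes≤runAux c b (true  ∷ xs) c≤b = ≤-trans (≤-reflexive (+-suc c (leadingOnes xs)))
  (+leadingOnes≤runAux (suc c) (b ⊔ suc c) xs (m≤n⊔m b (suc c)))
+leadingOnes≤runAux c b (false ∷ xs) c≤b = ≤-trans (≤-reflexive (+-identityʳ c))
  (≤-trans c≤b (best≤runAux zero b xs))

runAux-lub-length : ∀ {r} c b xs → b ≤ r → c + length xs ≤ r → runAux c b xs ≤ r
runAux-lub-length c b []           b≤r _ = b≤r
runAux-lub-length c b (true  ∷ xs) b≤r c+∣xs∣≤r =
  runAux-lub-length (suc c) (b ⊔ suc c) xs (⊔-lub b≤r (≤-trans (s≤s (m≤m+n c _)) 1+c+∣xs∣≤r)) 1+c+∣xs∣≤r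
  where 1+c+∣xs∣≤r = ≤-trans (≤-reflexive (sym (+-suc c (length xs)))) c+∣xs∣≤r
runAux-lub-length c b (false ∷ xs) b≤r c+∣xs∣≤r =
  runAux-lub-length zero b xs b≤r (≤-trans (≤-trans (n≤1+n _) (m≤n+m _ c)) c+∣xs∣≤r)

runAux-lub : ∀ {r} c b xs → b ≤ r → c + leadingOnes xs ≤ r → longestRun xs ≤ r → runAux c b xs ≤ r
runAux-lub c b []           b≤r _ _ = b≤r
runAux-lub c b (true  ∷ xs) b≤r c+lead≤r run≤r =
  runAux-lub (suc c) (b ⊔ suc c) xs (⊔-lub b≤r (≤-trans (s≤s (m≤m+n c _)) 1+c+lead≤r)) 1+c+lead≤r
    (≤-trans (runAux-mono xs z≤n z≤n) run≤r)
  where 1+c+lead≤r = ≤-trans (≤-reflexive (sym (+-suc c (leadingOnes xs)))) c+lead≤r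
runAux-lub c b (false ∷ xs) b≤r _ run≤r =
  runAux-lub zero b xs b≤r (≤-trans (+leadingOnes≤runAux 0 0 xs z≤n) run≤r) run≤r

longestRun≤length : ∀ xs → longestRun xs ≤ length xs
longestRun≤length xs = runAux-lub-length 0 0 xs z≤n ≤-refl

leadingOnes≤longestRun : ∀ xs → leadingOnes xs ≤ longestRun xs
leadingOnes≤longestRun xs = +leadingOnes≤runAux 0 0 xs z≤n

longestRun-++ˡ : ∀ xs ys → longestRun xs ≤ longestRun (xs ++ ys)
longestRun-++ˡ xs ys = ≤-trans (best≤runAux _ _ ys) (≤-reflexive (sym (runAux-++ 0 0 xs ys)))

longestRun-++ʳ : ∀ xs ys → longestRun ys ≤ longestRun (xs ++ ys)
longestRun-++ʳ xs ys = ≤-trans (runAux-mono ys z≤n z≤n) (≤-reflexive (sym (runAux-++ 0 0 xs ys)))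

longestRun-++-lub : ∀ {r} xs ys → longestRun xs ≤ r → endRun 0 xs + leadingOnes ys ≤ r →
                    longestRun ys ≤ r → longestRun (xs ++ ys) ≤ r
longestRun-++-lub xs ys xs≤r carry≤r ys≤r =
  ≤-trans (≤-reflexive (runAux-++ 0 0 xs ys)) (runAux-lub (endRun 0 xs) (longestRun xs) ys xs≤r carry≤r ys≤r)

longestRun-take : ∀ n xs → longestRun (take n xs) ≤ longestRun xs
longestRun-take n xs =
  ≤-trans (longestRun-++ˡ (take n xs) (drop n xs)) (≤-reflexive (cong longestRun (take++drop≡id n xs)))

take-++ : ∀ {A : Set} n (xs ys : List A) → length xs ≤ n →
          take n (xs ++ ys) ≡ xs ++ take (n ∸ length xs) ys
take-++ n       []       ys _            = refl
take-++ (suc n) (x ∷ xs) ys (s≤s ∣xs∣≤n) = cong (x ∷_) (take-++ n xs ys ∣xs∣≤n)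

longestRun≤take-++ : ∀ n xs ys → length xs ≤ n → longestRun xs ≤ longestRun (take n (xs ++ ys))
longestRun≤take-++ n xs ys ∣xs∣≤n =
  ≤-trans (longestRun-++ˡ xs _) (≤-reflexive (cong longestRun (sym (take-++ n xs ys ∣xs∣≤n))))

double : ℕ → ℕ
double zero    = zero
double (suc q) = suc (suc (double q))

double≡*2 : ∀ q → double q ≡ q * 2
double≡*2 zero    = refl
double≡*2 (suc q) = cong (suc ∘ suc) (double≡*2 q)

n≤double : ∀ n → n ≤ double n
n≤double n = ≤-trans (m≤m*n n 2) (≤-reflexive (sym (double≡*2 n)))

double/2 : ∀ q → double q / 2 ≡ q
double/2 q = trans (cong (_/ 2) (double≡*2 q)) (m*n/n≡m q 2)

double%2 : ∀ q → double q % 2 ≡ 0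
double%2 q = trans (cong (_% 2) (double≡*2 q)) (m*n%n≡0 q 2)

1+double/2 : ∀ q → suc (double q) / 2 ≡ q
1+double/2 q = begin
  suc (double q) / 2    ≡⟨ cong (λ m → suc m / 2) (double≡*2 q) ⟩
  (1 + q * 2) / 2       ≡⟨ +-distrib-/ 1 (q * 2) (subst (λ r → 1 + r < 2) (sym (m*n%n≡0 q 2)) ≤-refl) ⟩
  q * 2 / 2             ≡⟨ m*n/n≡m q 2 ⟩
  q                     ∎
  where open ≡-Reasoning

1+double%2 : ∀ q → suc (double q) % 2 ≡ 1
1+double%2 q = trans (cong (λ m → suc m % 2) (double≡*2 q)) ([m+kn]%n≡m%n 1 q 2)

-- n is 0, 2q+1 or 2(q+1), together with the view of q resp. q+1, so that recursion along
-- the binary digits of n is structural.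
data Binary : ℕ → Set where
  zero : Binary 0
  odd  : ∀ {q} → Binary q → Binary (suc (double q))
  even : ∀ {q} → Binary (suc q) → Binary (double (suc q))

binary-suc : ∀ {n} → Binary n → Binary (suc n)
binary-suc zero     = odd zero
binary-suc (odd b)  = even (binary-suc b)
binary-suc (even b) = odd b

binaryView : ∀ n → Binary n
binaryView zero    = zero
binaryView (suc n) = binary-suc (binaryView n)

bitsLE-odd : ∀ f q → bitsLE (suc f) (suc (double q)) ≡ true ∷ bitsLE f q
bitsLE-odd f q rewrite 1+double%2 q | 1+double/2 q = refl

bitsLE-even : ∀ f q → bitsLE (suc f) (double (suc q)) ≡ false ∷ bitsLE f (suc q)
bitsLE-even f q rewrite double%2 (suc q) | double/2 (suc q) = refl

bitsLE-zero : ∀ f → bitsLE f 0 ≡ []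
bitsLE-zero zero    = refl
bitsLE-zero (suc f) = refl

bitsLE-fuel : ∀ {n f g} → Binary n → n ≤ f → n ≤ g → bitsLE f n ≡ bitsLE g n
bitsLE-fuel {f = f} {g} zero _ _ = trans (bitsLE-zero f) (sym (bitsLE-zero g))
bitsLE-fuel {f = suc f} {suc g} (odd {q} b) (s≤s n≤f) (s≤s n≤g)
  rewrite bitsLE-odd f q | bitsLE-odd g q =
    cong (true ∷_) (bitsLE-fuel b (≤-trans (n≤double q) n≤f) (≤-trans (n≤double q) n≤g))
bitsLE-fuel {f = suc f} {suc g} (even {q} b) (s≤s n≤f) (s≤s n≤g)
  rewrite bitsLE-even f q | bitsLE-even g q =
    cong (false ∷_) (bitsLE-fuel b (≤-trans (s≤s (n≤double q)) n≤f) (≤-trans (s≤s (n≤double q)) n≤g))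

reverse-bitsLE : ∀ {f} n → n ≤ f → reverse (bitsLE f n) ≡ binary n
reverse-bitsLE n n≤f = cong reverse (bitsLE-fuel (binaryView n) n≤f ≤-refl)

binary-odd : ∀ q → binary (suc (double q)) ≡ binary q ∷ʳ true
binary-odd q = begin
  reverse (bitsLE (suc (double q)) (suc (double q)))  ≡⟨ cong reverse (bitsLE-odd (double q) q) ⟩
  reverse (true ∷ bitsLE (double q) q)                ≡⟨ unfold-reverse true (bitsLE (double q) q) ⟩
  reverse (bitsLE (double q) q) ∷ʳ true               ≡⟨ cong (_∷ʳ true) (reverse-bitsLE q (n≤double q)) ⟩
  binary q ∷ʳ true                                    ∎
  where open ≡-Reasoning

binary-even : ∀ q → binary (double (suc q)) ≡ binary (suc q) ∷ʳ false
binary-even q = begin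
  reverse (bitsLE (double (suc q)) (double (suc q)))
    ≡⟨ cong reverse (bitsLE-even (suc (double q)) q) ⟩
  reverse (false ∷ bitsLE (suc (double q)) (suc q))
    ≡⟨ unfold-reverse false (bitsLE (suc (double q)) (suc q)) ⟩
  reverse (bitsLE (suc (double q)) (suc q)) ∷ʳ false
    ≡⟨ cong (_∷ʳ false) (reverse-bitsLE (suc q) (s≤s (n≤double q))) ⟩
  binary (suc q) ∷ʳ false
    ∎
  where open ≡-Reasoning

length-∷ʳ : ∀ {A : Set} (xs : List A) x → length (xs ∷ʳ x) ≡ suc (length xs)
length-∷ʳ xs x = trans (length-++ xs) (+-comm (length xs) 1)

double<2*⇒< : ∀ {q p} → double q < 2 * p → q < p
double<2*⇒< {q} {p} 2q<2p = *-cancelʳ-< 2 q p (subst₂ _<_ (double≡*2 q) (*-comm 2 p) 2q<2p)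

length-binary≤ : ∀ {J} n → n < 2 ^ J → length (binary n) ≤ J
length-binary≤ n = go (binaryView n)
  where
  go : ∀ {J n} → Binary n → n < 2 ^ J → length (binary n) ≤ J
  go zero _ = z≤n
  go {zero}  (odd _)  (s≤s ())
  go {suc J} (odd {q} b) n<2^J rewrite binary-odd q | length-∷ʳ (binary q) true =
    s≤s (go b (double<2*⇒< (≤-trans (n≤1+n _) n<2^J)))
  go {zero}  (even _) (s≤s ())
  go {suc J} (even {q} b) n<2^J rewrite binary-even q | length-∷ʳ (binary (suc q)) false =
    s≤s (go b (double<2*⇒< n<2^J))

endRun-binary-double : ∀ q → endRun 0 (binary (double q)) ≡ 0
endRun-binary-double zero    = refl
endRun-binary-double (suc q) = trans (cong (endRun 0) (binary-even q)) (endRun-∷ʳ-false 0 (binary (suc q)))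

endRun-binary-suc : ∀ m → endRun (endRun 0 (binary m)) (binary (suc m)) ≡ endRun 0 (binary (suc m))
endRun-binary-suc m with binaryView m
... | zero       = refl
... | even {q} _ rewrite endRun-binary-double (suc q) = refl
... | odd  {q} _ rewrite binary-even q =
  trans (endRun-∷ʳ-false _ (binary (suc q))) (sym (endRun-∷ʳ-false 0 (binary (suc q))))

endRun+leadingOnes-binary : ∀ m →
                            endRun 0 (binary m) + leadingOnes (binary (suc m)) ≤ length (binary (suc m))
endRun+leadingOnes-binary m = go (binaryView m)
  where
  go : ∀ {m} → Binary m → endRun 0 (binary m) + leadingOnes (binary (suc m)) ≤ length (binary (suc m))
  go zero = s≤s z≤n
  go (even {q} _) rewrite endRun-binary-double (suc q) = leadingOnes≤length _
  go (odd {q} b)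
    rewrite binary-odd q | binary-even q | endRun-∷ʳ-true 0 (binary q)
          | leadingOnes-∷ʳ-false (binary (suc q)) | length-∷ʳ (binary (suc q)) false = s≤s (go b)

champernowne : ℕ → List Bool
champernowne m = concatMap (λ k → binary (suc k)) (upTo m)

champernowne-suc : ∀ m → champernowne (suc m) ≡ champernowne m ++ binary (suc m)
champernowne-suc m = begin
  concatMap f (upTo (suc m))                   ≡⟨ cong (concatMap f) (sym (upTo-∷ʳ m)) ⟩
  concatMap f (upTo m ∷ʳ m)                    ≡⟨ concatMap-++ f (upTo m) (m ∷ []) ⟩
  champernowne m ++ (binary (suc m) ++ [])     ≡⟨ cong (champernowne m ++_) (++-identityʳ (binary (suc m))) ⟩
  champernowne m ++ binary (suc m)             ∎
  where
  open ≡-Reasoning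
  f : ℕ → List Bool
  f k = binary (suc k)

champernowne-prefix : ∀ {m n} → m ≤ n → ∃ λ R → champernowne n ≡ champernowne m ++ R
champernowne-prefix m≤n = go (≤⇒≤′ m≤n)
  where
  go : ∀ {m n} → m ≤′ n → ∃ λ R → champernowne n ≡ champernowne m ++ R
  go {m} ≤′-refl = [] , sym (++-identityʳ (champernowne m))
  go {m} (≤′-step {n} m≤n) with go m≤n
  ... | R , eq = R ++ binary (suc n) , (begin
    champernowne (suc n)                     ≡⟨ champernowne-suc n ⟩
    champernowne n ++ binary (suc n)         ≡⟨ cong (_++ binary (suc n)) eq ⟩
    (champernowne m ++ R) ++ binary (suc n)  ≡⟨ ++-assoc (champernowne m) R (binary (suc n)) ⟩
    champernowne m ++ R ++ binary (suc n)    ∎)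
    where open ≡-Reasoning

length-champernowne≤ : ∀ {J} m → m < 2 ^ J → length (champernowne m) ≤ m * J
length-champernowne≤ zero      _       = z≤n
length-champernowne≤ {J} (suc m) 1+m<2^J = begin
  length (champernowne (suc m))                              ≡⟨ cong length (champernowne-suc m) ⟩
  length (champernowne m ++ binary (suc m))                  ≡⟨ length-++ (champernowne m) ⟩
  length (champernowne m) + length (binary (suc m))          ≤⟨ +-mono-≤ (length-champernowne≤ m (<⇒≤ 1+m<2^J))
                                                                         (length-binary≤ (suc m) 1+m<2^J) ⟩
  m * J + J                                                  ≡⟨ +-comm (m * J) J ⟩
  suc m * J                                                  ∎
  where open ≤-Reasoning

endRun-champernowne : ∀ m → endRun 0 (champernowne m) ≡ endRun 0 (binary m)
endRun-champernowne zero    = refl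
endRun-champernowne (suc m) = begin
  endRun 0 (champernowne (suc m))
    ≡⟨ cong (endRun 0) (champernowne-suc m) ⟩
  endRun 0 (champernowne m ++ binary (suc m))
    ≡⟨ endRun-++ 0 (champernowne m) (binary (suc m)) ⟩
  endRun (endRun 0 (champernowne m)) (binary (suc m))
    ≡⟨ cong (λ c → endRun c (binary (suc m))) (endRun-champernowne m) ⟩
  endRun (endRun 0 (binary m)) (binary (suc m))
    ≡⟨ endRun-binary-suc m ⟩
  endRun 0 (binary (suc m))
    ∎
  where open ≡-Reasoning

longestRun-champernowne≤ : ∀ {J} m → m < 2 ^ J → longestRun (champernowne m) ≤ J
longestRun-champernowne≤ zero _ = z≤n
longestRun-champernowne≤ {J} (suc m) 1+m<2^J =
  subst (λ xs → longestRun xs ≤ J) (sym (champernowne-suc m))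
    (longestRun-++-lub (champernowne m) (binary (suc m))
      (longestRun-champernowne≤ m (<⇒≤ 1+m<2^J)) carry≤ run≤)
  where
  ∣1+m∣≤J : length (binary (suc m)) ≤ J
  ∣1+m∣≤J = length-binary≤ (suc m) 1+m<2^J
  carry≤ : endRun 0 (champernowne m) + leadingOnes (binary (suc m)) ≤ J
  carry≤ rewrite endRun-champernowne m = ≤-trans (endRun+leadingOnes-binary m) ∣1+m∣≤J
  run≤ : longestRun (binary (suc m)) ≤ J
  run≤ = ≤-trans (longestRun≤length (binary (suc m))) ∣1+m∣≤J

longestRun-binary≤champernowne : ∀ m → longestRun (binary m) ≤ longestRun (champernowne m)
longestRun-binary≤champernowne zero    = z≤n
longestRun-binary≤champernowne (suc m) =
  ≤-trans (longestRun-++ʳ (champernowne m) (binary (suc m)))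
          (≤-reflexive (cong longestRun (sym (champernowne-suc m))))

L≤ : ∀ {J} n → n < 2 ^ J → L n ≤ J
L≤ n n<2^J = ≤-trans (longestRun-take n (champernowne n)) (longestRun-champernowne≤ n n<2^J)

longestRun-champernowne≤L : ∀ {m n} → m ≤ n → length (champernowne m) ≤ n →
                            longestRun (champernowne m) ≤ L n
longestRun-champernowne≤L {m} {n} m≤n ∣m∣≤n with champernowne-prefix m≤n
... | R , eq = ≤-trans (longestRun≤take-++ n (champernowne m) R ∣m∣≤n)
                       (≤-reflexive (cong (λ xs → longestRun (take n xs)) (sym eq)))

allOnes : ℕ → ℕ
allOnes zero    = zero
allOnes (suc j) = suc (double (allOnes j))

1+allOnes : ∀ j → suc (allOnes j) ≡ 2 ^ j
1+allOnes zero    = refl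
1+allOnes (suc j) = begin
  suc (suc (double (allOnes j)))  ≡⟨⟩
  double (suc (allOnes j))        ≡⟨ double≡*2 (suc (allOnes j)) ⟩
  suc (allOnes j) * 2             ≡⟨ *-comm (suc (allOnes j)) 2 ⟩
  2 * suc (allOnes j)             ≡⟨ cong (2 *_) (1+allOnes j) ⟩
  2 * 2 ^ j                       ∎
  where open ≡-Reasoning

replicate-∷ʳ : ∀ {A : Set} j (x : A) → replicate j x ∷ʳ x ≡ replicate (suc j) x
replicate-∷ʳ zero    x = refl
replicate-∷ʳ (suc j) x = cong (x ∷_) (replicate-∷ʳ j x)

binary-allOnes : ∀ j → binary (allOnes j) ≡ replicate j true
binary-allOnes zero    = refl
binary-allOnes (suc j) = begin
  binary (suc (double (allOnes j)))  ≡⟨ binary-odd (allOnes j) ⟩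
  binary (allOnes j) ∷ʳ true         ≡⟨ cong (_∷ʳ true) (binary-allOnes j) ⟩
  replicate j true ∷ʳ true           ≡⟨ replicate-∷ʳ j true ⟩
  replicate (suc j) true             ∎
  where open ≡-Reasoning

≤L : ∀ j n → j * 2 ^ j ≤ n → j ≤ L n
≤L zero    n _ = z≤n
≤L j@(suc _) n j2^j≤n = begin
  j                                    ≡⟨ sym (leadingOnes-replicate j) ⟩
  leadingOnes (replicate j true)       ≡⟨ cong leadingOnes (sym (binary-allOnes j)) ⟩
  leadingOnes (binary m)               ≤⟨ leadingOnes≤longestRun (binary m) ⟩
  longestRun (binary m)                ≤⟨ longestRun-binary≤champernowne m ⟩
  longestRun (champernowne m)          ≤⟨ longestRun-champernowne≤L m≤n ∣m∣≤n ⟩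
  L n                                  ∎
  where
  open ≤-Reasoning
  m = allOnes j
  m<2^j : m < 2 ^ j
  m<2^j = ≤-reflexive (1+allOnes j)
  m≤n : m ≤ n
  m≤n = ≤-trans (<⇒≤ m<2^j) (≤-trans (m≤n*m (2 ^ j) j) j2^j≤n)
  ∣m∣≤n : length (champernowne m) ≤ n
  ∣m∣≤n = ≤-trans (length-champernowne≤ m m<2^j)
            (≤-trans (*-monoˡ-≤ j (<⇒≤ m<2^j)) (≤-trans (≤-reflexive (*-comm (2 ^ j) j)) j2^j≤n))

n<2^n : ∀ n → n < 2 ^ n
n<2^n zero    = s≤s z≤n
n<2^n (suc n) = begin-strict
  suc n              ≡⟨ +-comm 1 n ⟩
  n + 1              <⟨ +-mono-≤ (n<2^n n) (m^n>0 2 n) ⟩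
  2 ^ n + 2 ^ n      ≡⟨ cong (2 ^ n +_) (sym (+-identityʳ (2 ^ n))) ⟩
  2 ^ suc n          ∎
  where open ≤-Reasoning

*≤2^ : ∀ c {t} → suc (c + c) ≤ t → c * t ≤ 2 ^ t
*≤2^ c t₀≤t = go (≤⇒≤′ t₀≤t)
  where
  open ≤-Reasoning
  square : ∀ c → c * suc (c + c) + suc (suc (c + c + c)) ≡ 2 * (suc c * suc c)
  square = solve-∀
  go : ∀ {t} → suc (c + c) ≤′ t → c * t ≤ 2 ^ t
  go ≤′-refl = begin
    c * suc (c + c)                          ≤⟨ m≤m+n _ _ ⟩
    c * suc (c + c) + suc (suc (c + c + c))  ≡⟨ square c ⟩
    2 * (suc c * suc c)                      ≤⟨ *-monoʳ-≤ 2 (*-mono-≤ (n<2^n c) (n<2^n c)) ⟩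
    2 * (2 ^ c * 2 ^ c)                      ≡⟨ cong (2 *_) (sym (^-distribˡ-+-* 2 c c)) ⟩
    2 ^ suc (c + c)                          ∎
  go (≤′-step {t} t₀≤t) = begin
    c * suc t          ≡⟨ *-suc c t ⟩
    c + c * t          ≤⟨ +-mono-≤ c≤2^t (go t₀≤t) ⟩
    2 ^ t + 2 ^ t      ≡⟨ cong (2 ^ t +_) (sym (+-identityʳ (2 ^ t))) ⟩
    2 ^ suc t          ∎
    where
    c≤2^t : c ≤ 2 ^ t
    c≤2^t = ≤-trans (≤-trans (m≤m+n c c) (≤-trans (n≤1+n _) (≤′⇒≤ t₀≤t))) (<⇒≤ (n<2^n t))

bracket : ∀ (f : ℕ → ℕ) → (∀ t → f t < f (suc t)) → ∀ {t₀ n} → f t₀ ≤ n →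
          ∃ λ t → t₀ ≤ t × f t ≤ n × n < f (suc t)
bracket f f-< {t₀} ft₀≤n = go (≤⇒≤′ ft₀≤n)
  where
  go : ∀ {n} → f t₀ ≤′ n → ∃ λ t → t₀ ≤ t × f t ≤ n × n < f (suc t)
  go ≤′-refl = t₀ , ≤-refl , ≤-refl , f-< t₀
  go (≤′-step {n} ft₀≤n) with go ft₀≤n
  ... | t , t₀≤t , ft≤n , n<ft′ with f (suc t) ≤? suc n
  ...   | yes ft′≤1+n = suc t , m≤n⇒m≤1+n t₀≤t , ft′≤1+n , ≤-<-trans n<ft′ (f-< (suc t))
  ...   | no  ft′≰1+n = t , t₀≤t , m≤n⇒m≤1+n ft≤n , ≰⇒> ft′≰1+n

[2+k][1+t]k<[1+k]²t : ∀ k t → suc (suc k) * k < t → suc (suc k) * suc t * k < suc k * (suc k * t)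
[2+k][1+t]k<[1+k]²t k t [2+k]k<t = begin-strict
  suc (suc k) * suc t * k                  ≡⟨ lhs k t ⟩
  suc (suc k) * k * t + suc (suc k) * k    <⟨ +-monoʳ-< (suc (suc k) * k * t) [2+k]k<t ⟩
  suc (suc k) * k * t + t                  ≡⟨ rhs k t ⟩
  suc k * (suc k * t)                      ∎
  where
  open ≤-Reasoning
  lhs : ∀ k t → suc (suc k) * suc t * k ≡ suc (suc k) * k * t + suc (suc k) * k
  lhs = solve-∀
  rhs : ∀ k t → suc (suc k) * k * t + t ≡ suc k * (suc k * t)
  rhs = solve-∀

Eventually : (ℕ → Set) → Set
Eventually P = ∃ λ N → ∀ n → n ≥ N → P n

eventually-× : ∀ {P Q} → Eventually P → Eventually Q → Eventually (λ n → P n × Q n)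
eventually-× (M , p) (N , q) =
  M ⊔ N , λ n n≥M⊔N → p n (≤-trans (m≤m⊔n M N) n≥M⊔N) , q n (≤-trans (m≤n⊔m M N) n≥M⊔N)

eventually-2^[a*L]<n^[1+a] : ∀ a → Eventually (λ n → 2 ^ (a * L n) < n ^ suc a)
eventually-2^[a*L]<n^[1+a] a = 2 ^ t₀ , λ n 2^t₀≤n → bound n (bracket (2 ^_) 2^-< 2^t₀≤n)
  where
  t₀ = suc a
  2^-< : ∀ t → 2 ^ t < 2 ^ suc t
  2^-< t = ^-monoʳ-< 2 (s≤s (s≤s z≤n)) (n<1+n t)
  bound : ∀ n → ∃ (λ j → t₀ ≤ j × 2 ^ j ≤ n × n < 2 ^ suc j) → 2 ^ (a * L n) < n ^ suc a
  bound n (j , t₀≤j , 2^j≤n , n<2^1+j) = begin-strict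
    2 ^ (a * L n)           ≤⟨ ^-monoʳ-≤ 2 (*-monoʳ-≤ a (L≤ n n<2^1+j)) ⟩
    2 ^ (a * suc j)         ≡⟨ cong (2 ^_) (*-suc a j) ⟩
    2 ^ (a + a * j)         <⟨ ^-monoʳ-< 2 (s≤s (s≤s z≤n)) (+-monoˡ-< (a * j) t₀≤j) ⟩
    2 ^ (suc a * j)         ≡⟨ cong (2 ^_) (*-comm (suc a) j) ⟩
    2 ^ (j * suc a)         ≡⟨ sym (^-*-assoc 2 j (suc a)) ⟩
    (2 ^ j) ^ suc a         ≤⟨ ^-monoˡ-≤ (suc a) 2^j≤n ⟩
    n ^ suc a               ∎
    where open ≤-Reasoning

eventually-n^k<2^[[1+k]*L] : ∀ k → Eventually (λ n → n ^ k < 2 ^ (suc k * L n))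
eventually-n^k<2^[[1+k]*L] k =
  2 ^ (b * T) , λ n 2^bT≤n → bound n (bracket (λ t → 2 ^ (b * t)) 2^b*-< 2^bT≤n)
  where
  a = suc k
  b = suc a
  -- t ≥ T gives both a t ≤ 2^t, so that the run of a t ones fits below 2^(b t) ≤ n, and
  -- b k < t, which the exponent comparison needs.
  T = suc (a + a + b * k)
  2^b*-< : ∀ t → 2 ^ (b * t) < 2 ^ (b * suc t)
  2^b*-< t = ^-monoʳ-< 2 (s≤s (s≤s z≤n)) (*-monoʳ-< b (n<1+n t))
  bound : ∀ n → ∃ (λ t → T ≤ t × 2 ^ (b * t) ≤ n × n < 2 ^ (b * suc t)) → n ^ k < 2 ^ (a * L n)
  bound n (t , T≤t , 2^bt≤n , n<2^b[1+t]) = begin-strict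
    n ^ k                    ≤⟨ ^-monoˡ-≤ k (<⇒≤ n<2^b[1+t]) ⟩
    (2 ^ (b * suc t)) ^ k    ≡⟨ ^-*-assoc 2 (b * suc t) k ⟩
    2 ^ (b * suc t * k)      <⟨ ^-monoʳ-< 2 (s≤s (s≤s z≤n)) ([2+k][1+t]k<[1+k]²t k t bk<t) ⟩
    2 ^ (a * (a * t))        ≤⟨ ^-monoʳ-≤ 2 (*-monoʳ-≤ a (≤L (a * t) n at2^at≤n)) ⟩
    2 ^ (a * L n)            ∎
    where
    open ≤-Reasoning
    bk<t : b * k < t
    bk<t = ≤-trans (s≤s (m≤n+m (b * k) (a + a))) T≤t
    at2^at≤n : a * t * 2 ^ (a * t) ≤ n
    at2^at≤n = begin
      a * t * 2 ^ (a * t)    ≤⟨ *-monoˡ-≤ (2 ^ (a * t)) (*≤2^ a (≤-trans (s≤s (m≤m+n (a + a) (b * k))) T≤t)) ⟩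
      2 ^ t * 2 ^ (a * t)    ≡⟨ sym (^-distribˡ-+-* 2 t (a * t)) ⟩
      2 ^ (b * t)            ≤⟨ 2^bt≤n ⟩
      n                      ∎

mainTheorem4 : (k : ℕ) → Σ ℕ (λ N → (n : ℕ) → n ≥ N →
                 (n ^ k < 2 ^ (suc k * L n)) × (2 ^ (suc k * L n) < n ^ (suc (suc k))))
mainTheorem4 k = eventually-× (eventually-n^k<2^[[1+k]*L] k) (eventually-2^[a*L]<n^[1+a] (suc k))
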